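{- Let $(\vec b; s, l; t, m)$ be an encoding of a subsequence of $W(\vec b)$ whose length is odd. Then the subsequence is trivial if and only if $s$ and $t$ have the same parity.
   Context: Fix $n \geq 0$. For a vector $\vec b = [b_0, \ldots, b_{2n}]$ of non-negative integers, let $W(\vec b)$ be the binary word $B_0 B_1 \cdots B_{2n}$, where block $B_j = (01)^{b_j+1}$ if $j$ is even and $B_j = (10)^{b_j+1}$ if $j$ is odd (blocks numbered from $0$). A subsequence is a nonempty contiguous substring of $W(\vec b)$. An encoding $(\vec b; s, l; t, m)$ consists of integers $0 \leq s \leq t \leq 2n$, $0 \leq l < 2(b_s+1)$, $0 \leq m < 2(b_t+1)$ (with $l+m<2(b_s+1)$ if $s=t$), and designates the subsequence which starts in block $s$ immediately after the first $l$ symbols of that block and ends in block $t$ immediately before the last $m$ symbols of that block. A subsequence is called trivial if its first and last symbols (its boundary symbols) are equal. -}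

module Defs where

open import Data.Nat using (ℕ; zero; suc; _+_; _*_; _∸_; _%_; _<_; _≤_)
open import Data.Bool using (Bool; true; false; if_then_else_)
open import Data.List using (List; []; _∷_; concat; replicate; take; drop; length; head; last)
open import Data.Vec using (Vec; lookup; allFin; toList; map)
open import Data.Fin using (Fin; toℕ)
open import Data.Maybe using (Maybe)
open import Data.Product using (_×_)
open import Relation.Binary.PropositionalEquality using (_≡_)

-- Symbols: false = 0, true = 1.

isEven : ℕ → Bool
isEven zero = true
isEven (suc zero) = false
isEven (suc (suc k)) = isEven k

block : ℕ → ℕ → List Bool
block j c = concat (replicate (suc c)
  (if isEven j then (false ∷ true ∷ []) else (true ∷ false ∷ [])))

blocks : ∀ {n : ℕ} → Vec ℕ (suc (2 * n)) → List (List Bool)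
blocks {n} b = toList (map (λ i → block (toℕ i) (lookup b i)) (allFin (suc (2 * n))))

W : ∀ n → Vec ℕ (suc (2 * n)) → List Bool
W n b = concat (blocks {n} b)

record IsEncoding {n : ℕ} (b : Vec ℕ (suc (2 * n)))
                  (s : Fin (suc (2 * n))) (l : ℕ)
                  (t : Fin (suc (2 * n))) (m : ℕ) : Set where
  field
    s≤t  : toℕ s ≤ toℕ t
    l<   : l < 2 * suc (lookup b s)
    m<   : m < 2 * suc (lookup b t)
    same : toℕ s ≡ toℕ t → l + m < 2 * suc (lookup b s)

-- the subsequence designated by (b; s, l; t, m): starts in block s right after
-- its first l symbols, ends in block t right before its last m symbols
subseq : ∀ n → Vec ℕ (suc (2 * n)) → Fin (suc (2 * n)) → ℕ → Fin (suc (2 * n)) → ℕ → List Bool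
subseq n b s l t m =
  let start = length (concat (take (toℕ s) (blocks {n} b))) + l
      end   = length (concat (take (suc (toℕ t)) (blocks {n} b))) ∸ m
  in take (end ∸ start) (drop start (W n b))

Trivial : List Bool → Set
Trivial xs = head xs ≡ last xs

-- All blocks have even length, so the symbol at absolute position p of W(b) is
-- determined by the parity of p together with the parity of the index of the block
-- containing p.  A subsequence of odd length starts and ends at positions of the
-- same parity; hence its boundary symbols agree exactly when the blocks s and t
-- have the same parity.
module Submission where

open import Defs
open import Data.Nat using (ℕ; zero; suc; _+_; _*_; _∸_; _%_; _≤_; _<_; z≤n; s≤s)
open import Data.Nat.Properties
open import Data.Bool using (Bool; true; false; not; _xor_; if_then_else_)
open import Data.Bool.Properties using (xor-identityʳ; xor-comm; not-involutive)
open import Data.Maybe using (Maybe; just; nothing)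
open import Data.Maybe.Properties using (just-injective)
open import Data.List using (List; []; _∷_; _++_; concat; replicate; take; drop; length; head; last)
open import Data.List.Properties using (length-++; length-take; length-drop)
open import Data.List.Relation.Unary.All using (All; _∷_)
open import Data.Vec as V using (Vec; lookup; allFin; toList; map)
open import Data.Vec.Properties using (lookup-map; lookup-allFin)
import Data.Vec.Relation.Unary.All as VecAll
open import Data.Vec.Relation.Unary.All.Properties using (toList⁺; map⁺)
open import Data.Fin using (Fin; toℕ)
import Data.Fin as Fin
open import Data.Product using (∃; _×_; _,_)
open import Function using (_∘_)
open import Function.Bundles using (_⇔_; mk⇔)
import Function.Properties.Equivalence as ⇔
open import Relation.Binary.PropositionalEquality
  using (_≡_; refl; sym; trans; cong; subst; module ≡-Reasoning)

private variable
  A X : Set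

isEven-+ˡ : ∀ x y → isEven x ≡ true → isEven (x + y) ≡ isEven y
isEven-+ˡ zero          y _      = refl
isEven-+ˡ (suc (suc x)) y x-even = isEven-+ˡ x y x-even

isEven-+ʳ : ∀ x y → isEven y ≡ true → isEven (x + y) ≡ isEven x
isEven-+ʳ x y y-even = trans (cong isEven (+-comm x y)) (isEven-+ˡ y x y-even)

isEven-2* : ∀ c → isEven (2 * c) ≡ true
isEven-2* zero    = refl
isEven-2* (suc c) = trans (cong isEven (*-suc 2 c)) (isEven-2* c)

%2≡isEven : ∀ x → x % 2 ≡ (if isEven x then 0 else 1)
%2≡isEven zero          = refl
%2≡isEven (suc zero)    = refl
%2≡isEven (suc (suc x)) = %2≡isEven x

isEven-≡⇔%2-≡ : ∀ x y → (isEven x ≡ isEven y) ⇔ (x % 2 ≡ y % 2)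
isEven-≡⇔%2-≡ x y rewrite %2≡isEven x | %2≡isEven y with isEven x | isEven y
... | true  | true  = mk⇔ (λ _ → refl) (λ _ → refl)
... | false | false = mk⇔ (λ _ → refl) (λ _ → refl)
... | true  | false = mk⇔ (λ ()) (λ ())
... | false | true  = mk⇔ (λ ()) (λ ())

%2≡1⇒suc-even : ∀ x → x % 2 ≡ 1 → ∃ λ k → x ≡ suc k × isEven k ≡ true
%2≡1⇒suc-even (suc zero)    _   = zero , refl , refl
%2≡1⇒suc-even (suc (suc x)) odd with %2≡1⇒suc-even x odd
... | k , refl , k-even = suc (suc k) , refl , k-even

xor-cancelʳ-⇔ : ∀ x y z → (x xor z ≡ y xor z) ⇔ (x ≡ y)
xor-cancelʳ-⇔ true  true  z     = mk⇔ (λ _ → refl) (λ _ → refl)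
xor-cancelʳ-⇔ false false z     = mk⇔ (λ _ → refl) (λ _ → refl)
xor-cancelʳ-⇔ true  false true  = mk⇔ (λ ()) (λ ())
xor-cancelʳ-⇔ true  false false = mk⇔ (λ ()) (λ ())
xor-cancelʳ-⇔ false true  true  = mk⇔ (λ ()) (λ ())
xor-cancelʳ-⇔ false true  false = mk⇔ (λ ()) (λ ())

nth : List A → ℕ → Maybe A
nth []       _       = nothing
nth (x ∷ xs) zero    = just x
nth (x ∷ xs) (suc i) = nth xs i

head≡nth-0 : ∀ (xs : List A) → head xs ≡ nth xs 0
head≡nth-0 []       = refl
head≡nth-0 (x ∷ xs) = refl

last≡nth-pred-length : ∀ (xs : List A) → last xs ≡ nth xs (length xs ∸ 1)
last≡nth-pred-length []           = refl
last≡nth-pred-length (x ∷ [])     = refl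
last≡nth-pred-length (x ∷ y ∷ xs) = last≡nth-pred-length (y ∷ xs)

nth-take : ∀ k (xs : List A) {i} → i < k → nth (take k xs) i ≡ nth xs i
nth-take (suc k) []       _         = refl
nth-take (suc k) (x ∷ xs) {zero}  _ = refl
nth-take (suc k) (x ∷ xs) {suc i} (s≤s i<k) = nth-take k xs i<k

nth-drop : ∀ a (xs : List A) i → nth (drop a xs) i ≡ nth xs (a + i)
nth-drop zero    xs       i = refl
nth-drop (suc a) []       i = refl
nth-drop (suc a) (x ∷ xs) i = nth-drop a xs i

nth-++ˡ : ∀ (xs ys : List A) {i} → i < length xs → nth (xs ++ ys) i ≡ nth xs i
nth-++ˡ (x ∷ xs) ys {zero}  _         = refl
nth-++ˡ (x ∷ xs) ys {suc i} (s≤s i<n) = nth-++ˡ xs ys i<n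

nth-++ʳ : ∀ (xs ys : List A) i → nth (xs ++ ys) (length xs + i) ≡ nth ys i
nth-++ʳ []       ys i = refl
nth-++ʳ (x ∷ xs) ys i = nth-++ʳ xs ys i

trivial⇔ : ∀ {xs : List Bool} {x y} → head xs ≡ just x → last xs ≡ just y →
           Trivial xs ⇔ (x ≡ y)
trivial⇔ head≡ last≡ = mk⇔ (λ h≡l → just-injective (trans (sym head≡) (trans h≡l last≡)))
                           (λ x≡y → trans head≡ (trans (cong just x≡y) (sym last≡)))

drop-toList : ∀ {N} (v : Vec X N) (i : Fin N) →
              ∃ λ r → drop (toℕ i) (toList v) ≡ lookup v i ∷ r
drop-toList (x V.∷ v) Fin.zero    = toList v , refl
drop-toList (x V.∷ v) (Fin.suc i) = drop-toList v i

offset : List (List A) → ℕ → ℕ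
offset xss i = length (concat (take i xss))

nth-concat-offset : ∀ (xss : List (List A)) i {xs r} → drop i xss ≡ xs ∷ r →
                    ∀ {q} → q < length xs → nth (concat xss) (offset xss i + q) ≡ nth xs q
nth-concat-offset xss        zero    {xs} {r} refl q< = nth-++ˡ xs (concat r) q<
nth-concat-offset (ys ∷ xss) (suc i) {xs} eq {q} q< = begin
  nth (ys ++ concat xss) (length (ys ++ concat (take i xss)) + q)
    ≡⟨ cong (λ k → nth (ys ++ concat xss) (k + q)) (length-++ ys) ⟩
  nth (ys ++ concat xss) (length ys + offset xss i + q)
    ≡⟨ cong (nth (ys ++ concat xss)) (+-assoc (length ys) (offset xss i) q) ⟩
  nth (ys ++ concat xss) (length ys + (offset xss i + q))
    ≡⟨ nth-++ʳ ys (concat xss) (offset xss i + q) ⟩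
  nth (concat xss) (offset xss i + q)
    ≡⟨ nth-concat-offset xss i eq q< ⟩
  nth xs q ∎
  where open ≡-Reasoning

offset-suc : ∀ (xss : List (List A)) i {xs r} → drop i xss ≡ xs ∷ r →
             offset xss (suc i) ≡ offset xss i + length xs
offset-suc xss        zero    {xs} refl = trans (length-++ xs) (+-identityʳ (length xs))
offset-suc (ys ∷ xss) (suc i) {xs} eq = begin
  length (ys ++ concat (take (suc i) xss))  ≡⟨ length-++ ys ⟩
  length ys + offset xss (suc i)            ≡⟨ cong (length ys +_) (offset-suc xss i eq) ⟩
  length ys + (offset xss i + length xs)    ≡⟨ +-assoc (length ys) _ _ ⟨
  length ys + offset xss i + length xs      ≡⟨ cong (_+ length xs) (length-++ ys) ⟨
  offset (ys ∷ xss) (suc i) + length xs     ∎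
  where open ≡-Reasoning

offset≤length : ∀ (xss : List (List A)) i → offset xss i ≤ length (concat xss)
offset≤length xss        zero    = z≤n
offset≤length []         (suc i) = z≤n
offset≤length (ys ∷ xss) (suc i) = begin
  length (ys ++ concat (take i xss))  ≡⟨ length-++ ys ⟩
  length ys + offset xss i            ≤⟨ +-monoʳ-≤ (length ys) (offset≤length xss i) ⟩
  length ys + length (concat xss)     ≡⟨ length-++ ys ⟨
  length (ys ++ concat xss)           ∎
  where open ≤-Reasoning

offset-even : ∀ (xss : List (List A)) i →
              All (λ xs → isEven (length xs) ≡ true) xss → isEven (offset xss i) ≡ true
offset-even xss        zero    _ = refl
offset-even []         (suc i) _ = refl
offset-even (ys ∷ xss) (suc i) (ys-even ∷ xss-even) = begin
  isEven (length (ys ++ concat (take i xss)))  ≡⟨ cong isEven (length-++ ys) ⟩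
  isEven (length ys + offset xss i)            ≡⟨ isEven-+ˡ (length ys) _ ys-even ⟩
  isEven (offset xss i)                        ≡⟨ offset-even xss i xss-even ⟩
  true                                         ∎
  where open ≡-Reasoning

symbol : ℕ → ℕ → Bool
symbol j p = isEven j xor isEven p

symbol-≡⇔ : ∀ j j' {p p'} → isEven p ≡ isEven p' →
            (symbol j p ≡ symbol j' p') ⇔ (j % 2 ≡ j' % 2)
symbol-≡⇔ j j' {p} {p'} p≡p' rewrite p≡p' =
  ⇔.trans (xor-cancelʳ-⇔ (isEven j) (isEven j') (isEven p')) (isEven-≡⇔%2-≡ j j')

length-concat-replicate-pair : ∀ (x y : Bool) k → length (concat (replicate k (x ∷ y ∷ []))) ≡ 2 * k
length-concat-replicate-pair x y zero    = refl
length-concat-replicate-pair x y (suc k) =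
  trans (cong (suc ∘ suc) (length-concat-replicate-pair x y k)) (sym (*-suc 2 k))

nth-alternating : ∀ x c {q} → q < 2 * suc c →
                  nth (concat (replicate (suc c) (x ∷ not x ∷ []))) q ≡ just (not (isEven q) xor x)
nth-alternating x c       {zero}        _  = refl
nth-alternating x c       {suc zero}    _  = refl
nth-alternating x zero    {suc (suc q)} (s≤s (s≤s ()))
nth-alternating x (suc c) {suc (suc q)} q< =
  nth-alternating x c (≤-pred (≤-pred (subst (3 + q ≤_) (*-suc 2 (suc c)) q<)))

block-length : ∀ j c → length (block j c) ≡ 2 * suc c
block-length j c with isEven j
... | true  = length-concat-replicate-pair false true (suc c)
... | false = length-concat-replicate-pair true false (suc c)

nth-block : ∀ j c {q} → q < 2 * suc c → nth (block j c) q ≡ just (symbol j q)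
nth-block j c {q} q< with isEven j
... | true  = trans (nth-alternating false c q<) (cong just (xor-identityʳ _))
... | false = trans (nth-alternating true c q<)
                    (cong just (trans (xor-comm _ true) (not-involutive _)))

module _ {n : ℕ} (b : Vec ℕ (suc (2 * n))) where

  blockAt : Fin (suc (2 * n)) → List Bool
  blockAt i = block (toℕ i) (lookup b i)

  blockStart : Fin (suc (2 * n)) → ℕ
  blockStart i = offset (blocks {n} b) (toℕ i)

  drop-blocks : ∀ i → ∃ λ r → drop (toℕ i) (blocks {n} b) ≡ blockAt i ∷ r
  drop-blocks i with drop-toList (map blockAt (allFin _)) i
  ... | r , eq = r , trans eq (cong (_∷ r) (trans (lookup-map i blockAt (allFin _))
                                                  (cong blockAt (lookup-allFin i))))

  blockStart-even : ∀ i → isEven (blockStart i) ≡ true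
  blockStart-even i = offset-even (blocks {n} b) (toℕ i)
    (toList⁺ (map⁺ (VecAll.universal block-even (allFin _))))
    where
    block-even : ∀ j → isEven (length (blockAt j)) ≡ true
    block-even j = trans (cong isEven (block-length (toℕ j) (lookup b j)))
                         (isEven-2* (suc (lookup b j)))

  blockEnd≡ : ∀ i → offset (blocks {n} b) (suc (toℕ i)) ≡ blockStart i + 2 * suc (lookup b i)
  blockEnd≡ i with drop-blocks i
  ... | r , eq = trans (offset-suc (blocks {n} b) (toℕ i) eq)
                       (cong (blockStart i +_) (block-length (toℕ i) (lookup b i)))

  nth-W : ∀ i {q} → q < 2 * suc (lookup b i) →
          nth (W n b) (blockStart i + q) ≡ just (symbol (toℕ i) (blockStart i + q))
  nth-W i {q} q< with drop-blocks i
  ... | r , eq = begin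
    nth (W n b) (blockStart i + q)             ≡⟨ nth-concat-offset (blocks {n} b) (toℕ i) eq q<′ ⟩
    nth (blockAt i) q                          ≡⟨ nth-block (toℕ i) (lookup b i) q< ⟩
    just (symbol (toℕ i) q)                    ≡⟨ cong (just ∘ (isEven (toℕ i) xor_))
                                                        (isEven-+ˡ (blockStart i) q (blockStart-even i)) ⟨
    just (symbol (toℕ i) (blockStart i + q))   ∎
    where
    open ≡-Reasoning
    q<′ : q < length (blockAt i)
    q<′ = subst (q <_) (sym (block-length (toℕ i) (lookup b i))) q<

module _ {n : ℕ} {b : Vec ℕ (suc (2 * n))} {s : Fin (suc (2 * n))} {l : ℕ}
         {t : Fin (suc (2 * n))} {m : ℕ} (enc : IsEncoding {n} b s l t m) where

  open IsEncoding enc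

  private
    start end lastOffset : ℕ
    start = blockStart {n} b s + l
    end   = offset (blocks {n} b) (suc (toℕ t)) ∸ m
    -- the last symbol of the subsequence sits at this position of block t
    lastOffset = 2 * suc (lookup b t) ∸ suc m
    sub : List Bool
    sub = subseq n b s l t m

  end≡ : end ≡ blockStart {n} b t + suc lastOffset
  end≡ = begin
    offset (blocks {n} b) (suc (toℕ t)) ∸ m          ≡⟨ cong (_∸ m) (blockEnd≡ {n} b t) ⟩
    blockStart {n} b t + 2 * suc (lookup b t) ∸ m    ≡⟨ +-∸-assoc (blockStart {n} b t) (<⇒≤ m<) ⟩
    blockStart {n} b t + (2 * suc (lookup b t) ∸ m)  ≡⟨ cong (blockStart {n} b t +_) (+-∸-assoc 1 m<) ⟩
    blockStart {n} b t + suc lastOffset              ∎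
    where open ≡-Reasoning

  length-subseq : length sub ≡ end ∸ start
  length-subseq = trans (length-take (end ∸ start) (drop start (W n b)))
    (m≤n⇒m⊓n≡m (subst (end ∸ start ≤_) (sym (length-drop start (W n b)))
      (∸-monoˡ-≤ start (≤-trans (m∸n≤m _ m) (offset≤length (blocks {n} b) (suc (toℕ t)))))))

  head-subseq : ∀ {k} → length sub ≡ suc k → head sub ≡ just (symbol (toℕ s) start)
  head-subseq {k} len≡ = begin
    head sub                     ≡⟨ head≡nth-0 sub ⟩
    nth sub 0                    ≡⟨ nth-take (end ∸ start) (drop start (W n b)) 0<width ⟩
    nth (drop start (W n b)) 0   ≡⟨ nth-drop start (W n b) 0 ⟩
    nth (W n b) (start + 0)      ≡⟨ cong (nth (W n b)) (+-identityʳ start) ⟩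
    nth (W n b) start            ≡⟨ nth-W {n} b s l< ⟩
    just (symbol (toℕ s) start)  ∎
    where
    open ≡-Reasoning
    0<width : 0 < end ∸ start
    0<width = subst (0 <_) (trans (sym len≡) length-subseq) (s≤s z≤n)

  lastPosition≡ : ∀ {k} → length sub ≡ suc k → start + k ≡ blockStart {n} b t + lastOffset
  lastPosition≡ {k} len≡ = suc-injective (begin
    suc (start + k)                        ≡⟨ +-suc start k ⟨
    start + suc k                          ≡⟨ cong (start +_) width≡ ⟨
    start + (end ∸ start)                  ≡⟨ m+[n∸m]≡n start≤end ⟩
    end                                    ≡⟨ end≡ ⟩
    blockStart {n} b t + suc lastOffset    ≡⟨ +-suc (blockStart {n} b t) lastOffset ⟩
    suc (blockStart {n} b t + lastOffset)  ∎)
    where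
    open ≡-Reasoning
    width≡ : end ∸ start ≡ suc k
    width≡ = trans (sym length-subseq) len≡
    start≤end : start ≤ end
    start≤end = <⇒≤ (m∸n≢0⇒n<m (λ width≡0 → 1+n≢0 (trans (sym width≡) width≡0)))

  last-subseq : ∀ {k} → length sub ≡ suc k → last sub ≡ just (symbol (toℕ t) (start + k))
  last-subseq {k} len≡ = begin
    last sub                         ≡⟨ last≡nth-pred-length sub ⟩
    nth sub (length sub ∸ 1)         ≡⟨ cong (λ i → nth sub (i ∸ 1)) len≡ ⟩
    nth sub k                        ≡⟨ nth-take (end ∸ start) (drop start (W n b)) k<width ⟩
    nth (drop start (W n b)) k       ≡⟨ nth-drop start (W n b) k ⟩
    nth (W n b) (start + k)          ≡⟨ cong (nth (W n b)) (lastPosition≡ len≡) ⟩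
    nth (W n b) (blockStart {n} b t + lastOffset)
      ≡⟨ nth-W {n} b t (subst (_≤ 2 * suc (lookup b t)) (+-∸-assoc 1 m<) (m∸n≤m _ m)) ⟩
    just (symbol (toℕ t) (blockStart {n} b t + lastOffset))
      ≡⟨ cong (just ∘ symbol (toℕ t)) (lastPosition≡ len≡) ⟨
    just (symbol (toℕ t) (start + k)) ∎
    where
    open ≡-Reasoning
    k<width : k < end ∸ start
    k<width = subst (k <_) (trans (sym len≡) length-subseq) ≤-refl

mainTheorem5 : (n : ℕ) (b : Vec ℕ (suc (2 * n))) (s : Fin (suc (2 * n))) (l : ℕ)
    (t : Fin (suc (2 * n))) (m : ℕ) → IsEncoding {n} b s l t m →
    length (subseq n b s l t m) % 2 ≡ 1 →
    (Trivial (subseq n b s l t m) ⇔ (toℕ s % 2 ≡ toℕ t % 2))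
mainTheorem5 n b s l t m enc odd with %2≡1⇒suc-even _ odd
... | k , len≡ , k-even =
  ⇔.trans (trivial⇔ (head-subseq enc len≡) (last-subseq enc len≡))
          (symbol-≡⇔ (toℕ s) (toℕ t) {start} {start + k} (sym (isEven-+ʳ start k k-even)))
  where
  start : ℕ
  start = blockStart {n} b s + l
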